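{- Let $\lambda$ be a partition and $\phi$ a flag for $\lambda$. For a semistandard set-valued tableau $T$ of shape $\lambda$ with entries bounded by $\phi$, let $T_-$ be the tableau formed by the non-positive values in the cells of $T$ (its shape is a partition $\nu\subseteq\lambda$, consisting of the cells containing at least one non-positive value) and $T_+$ the tableau formed by the positive values (its shape is $\lambda/\mu$, where $\mu$ consists of the cells all of whose entries are non-positive). Then $T\mapsto(T_-,T_+)$ is a bijection $$\mathrm{SetSSYT}^\phi(\lambda)\to\bigsqcup_{\nu\subseteq\lambda}\mathrm{SetSSYT}^{\phi^- }(\nu)\times\Big(\bigsqcup_{\mu\subseteq\nu:\ \nu/\mu\ \text{disconnected}}\mathrm{SetSSYT}^{\phi^+}_+(\lambda/\mu)\Big).$$
   Context: Partitions are Young diagrams $\{(r,c):1\le r\le\ell(\lambda),1\le c\le\lambda_r\}$; for $\mu\subseteq\lambda$ the skew shape $\lambda/\mu$ is the set of cells of $\lambda$ not in $\mu$. A set-valued tableau of shape $\lambda/\mu$ assigns a nonempty finite subset of $\mathbb{Z}$ to each cell; it is semistandard if $\max T(r,c)\le\min T(r,c+1)$ and $\max T(r,c)<\min T(r+1,c)$ whenever both cells lie in the shape. A flag for $\lambda$ is a weakly increasing integer sequence $(\phi_1\le\dots\le\phi_{\ell(\lambda)})$; $\mathrm{SetSSYT}^\phi(\lambda/\mu)$ is the set of semistandard set-valued tableaux of shape $\lambda/\mu$ with $\max T(r,c)\le\phi_r$ for all cells, and the subscript $+$ restricts to tableaux all of whose entries are positive integers. $\phi^-_i=\min(\phi_i,0)$,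 $\phi^+_i=\max(\phi_i,0)$ (for $\nu\subseteq\lambda$ only the first $\ell(\nu)$ entries of $\phi^-$ are used). A skew shape is disconnected if it contains no two horizontally or vertically adjacent cells. -}

module Defs where

open import Data.Bool using (Bool; true; false; if_then_else_; not)
open import Data.Nat as ℕ using (ℕ; zero; suc; _∸_; _<ᵇ_)
open import Data.Integer as ℤ using (ℤ; 0ℤ; _⊓_; _⊔_)
open import Data.List using (List; []; _∷_; length; map; filterᵇ; take; null)
open import Data.Bool.ListAction using (all; any)
open import Data.List.Relation.Unary.All using (All)
open import Data.List.Relation.Unary.Linked using (Linked)
open import Data.Maybe using (Maybe; just; nothing)
open import Data.Product using (_×_; _,_)
open import Relation.Binary.PropositionalEquality using (_≡_; _≢_)

_!!_ : {A : Set} → List A → ℕ → Maybe A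
[] !! _ = nothing
(x ∷ xs) !! zero = just x
(x ∷ xs) !! suc n = xs !! n

partAt : List ℕ → ℕ → ℕ
partAt [] _ = 0
partAt (x ∷ xs) zero = x
partAt (x ∷ xs) (suc n) = partAt xs n

IsPartition : List ℕ → Set
IsPartition λ′ = Linked ℕ._≥_ λ′ × All (ℕ._<_ 0) λ′

_⊆ₚ_ : List ℕ → List ℕ → Set
μ ⊆ₚ λ′ = ∀ r → partAt μ r ℕ.≤ partAt λ′ r

InSkew : List ℕ → List ℕ → ℕ → ℕ → Set
InSkew λ′ μ r c = (partAt μ r ℕ.≤ c) × (c ℕ.< partAt λ′ r)

Disconnected : List ℕ → List ℕ → Set
Disconnected λ′ μ = ∀ r c → InSkew λ′ μ r c →
  (InSkew λ′ μ r (suc c) → Data.Empty.⊥) × (InSkew λ′ μ (suc r) c → Data.Empty.⊥)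
  where import Data.Empty

IsFlag : List ℤ → List ℕ → Set
IsFlag φ λ′ = Linked ℤ._≤_ φ × (length φ ≡ length λ′)

-- A finite subset of ℤ is represented canonically by the strictly
-- increasing list of its elements.  A tableau of skew shape λ/μ is a
-- list of rows; row r (0-based) lists the cells in columns
-- partAt μ r, …, partAt λ r − 1 (0-based) from left to right.

FinSet : Set
FinSet = List ℤ

Tab : Set
Tab = List (List FinSet)

IsEntry : FinSet → Set
IsEntry X = (X ≢ []) × Linked ℤ._<_ X

cell : List ℕ → Tab → ℕ → ℕ → Maybe FinSet
cell μ T r c = go (T !! r)
  where
  go : Maybe (List FinSet) → Maybe FinSet
  go nothing = nothing
  go (just row) = if c <ᵇ partAt μ r then nothing else (row !! (c ∸ partAt μ r))

record IsSSYT (φ : List ℤ) (λ′ μ : List ℕ) (T : Tab) : Set where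
  field
    nrows    : length T ≡ length λ′
    rowLen   : ∀ r row → T !! r ≡ just row → length row ≡ partAt λ′ r ∸ partAt μ r
    entries  : ∀ r c X → cell μ T r c ≡ just X → IsEntry X
    rowWeak  : ∀ r c X Y → cell μ T r c ≡ just X → cell μ T r (suc c) ≡ just Y →
               All (λ x → All (λ y → x ℤ.≤ y) Y) X
    colStrict : ∀ r c X Y → cell μ T r c ≡ just X → cell μ T (suc r) c ≡ just Y →
               All (λ x → All (λ y → x ℤ.< y) Y) X
    bounded  : ∀ r c X b → cell μ T r c ≡ just X → φ !! r ≡ just b →
               All (λ x → x ℤ.≤ b) X

AllPositive : List ℕ → Tab → Set
AllPositive μ T = ∀ r c X → cell μ T r c ≡ just X → All (λ x → 0ℤ ℤ.< x) X

flagNeg : List ℤ → List ℤ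
flagNeg = map (λ x → x ⊓ 0ℤ)

flagPos : List ℤ → List ℤ
flagPos = map (λ x → x ⊔ 0ℤ)

isNonPos : ℤ → Bool
isNonPos x = x ℤ.≤ᵇ 0ℤ

isPos : ℤ → Bool
isPos x = not (x ℤ.≤ᵇ 0ℤ)

nonEmpty : {A : Set} → List A → Bool
nonEmpty xs = not (null xs)

negPart : Tab → Tab
negPart T = filterᵇ nonEmpty (map (λ row → filterᵇ nonEmpty (map (filterᵇ isNonPos) row)) T)

nuShape : Tab → List ℕ
nuShape T = filterᵇ (λ n → 0 <ᵇ n) (map (λ row → length (filterᵇ (any isNonPos) row)) T)

muShape : Tab → List ℕ
muShape T = filterᵇ (λ n → 0 <ᵇ n) (map (λ row → length (filterᵇ (all isNonPos) row)) T)

posPart : Tab → Tab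
posPart T = map (λ row → filterᵇ nonEmpty (map (filterᵇ isPos) row)) T

record Split : Set where
  constructor split
  field
    ν   : List ℕ
    Tm  : Tab
    μ   : List ℕ
    Tp  : Tab

splitMap : Tab → Split
splitMap T = split (nuShape T) (negPart T) (muShape T) (posPart T)

InTarget : List ℤ → List ℕ → Split → Set
InTarget φ λ′ (split ν S μ U) =
  IsPartition ν × ν ⊆ₚ λ′ × IsSSYT (take (length ν) (flagNeg φ)) ν [] S ×
  IsPartition μ × μ ⊆ₚ ν × Disconnected ν μ ×
  IsSSYT (flagPos φ) λ′ μ U × AllPositive μ U

-- A cell of T splits into its non-positive values (a cell of T₋) and its positive values (a cell
-- of T₊). Since values weakly increase along rows and strictly increase down columns, the cells
-- holding some non-positive value form an initial segment of each row, and these segments form a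
-- Young diagram ν; likewise the cells holding only non-positive values form μ ⊆ ν. A cell of ν/μ
-- holds values of both signs, so its neighbours to the right and below hold only positive values:
-- ν/μ is disconnected. Conversely, gluing S and U cellwise gives a semistandard tableau of shape λ,
-- because every value of S is ≤ 0 < every value of U, and the only possible violation, a cell of U
-- left of or above a cell of S, would be two adjacent cells of ν/μ. Splitting and gluing are
-- mutually inverse cell by cell.

module Submission where

open import Defs
open import Data.Nat using (ℕ)
open import Data.Integer using (ℤ)
open import Data.List using (List; [])
open import Data.Product using (_×_; ∃)
open import Relation.Binary.PropositionalEquality using (_≡_)

open import Data.Bool using (Bool; true; false; not; _∨_; if_then_else_; T; T?)
open import Data.Bool.Properties using (T-≡; not-involutive)
open import Data.Bool.ListAction using (all; any)
open import Data.Nat as ℕ using (zero; suc; _+_; _∸_; z≤n; s≤s; _<ᵇ_)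
import Data.Nat.Properties as ℕP
open import Data.Integer as ℤ using (0ℤ; _⊓_; _⊔_)
import Data.Integer.Properties as ℤP
open import Data.List as List using (_∷_; _++_; length; map; filterᵇ; take; upTo)
import Data.List.Properties as ListP
open import Data.List.Relation.Unary.All as All using (All; []; _∷_)
import Data.List.Relation.Unary.All.Properties as AllP
open import Data.List.Relation.Unary.Linked as Linked using (Linked; []; [-]; _∷_)
import Data.List.Relation.Unary.Linked.Properties as LinkedP
open import Data.Maybe as Maybe using (Maybe; just; nothing; fromMaybe; _>>=_)
open import Data.Maybe.Properties using (just-injective)
open import Data.Maybe.Relation.Unary.All using (just; nothing; drop-just) renaming (All to MaybeAll)
open import Data.Product using (_,_; proj₁; proj₂)
open import Data.Empty using (⊥; ⊥-elim)
open import Data.Unit using (tt)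
open import Data.Sum using (inj₁; inj₂)
open import Function using (id; _∘_; Equivalence; case_of_)
open import Relation.Binary.PropositionalEquality
  using (refl; sym; trans; cong; cong₂; subst; subst₂; _≢_; module ≡-Reasoning)
open import Relation.Nullary using (¬_; Dec; yes; no; contradiction)

private
  variable
    A B : Set

!!-map : (f : A → B) (xs : List A) (i : ℕ) → map f xs !! i ≡ Maybe.map f (xs !! i)
!!-map f [] i = refl
!!-map f (x ∷ xs) zero = refl
!!-map f (x ∷ xs) (suc i) = !!-map f xs i

!!-extensionality : (xs ys : List A) → (∀ i → xs !! i ≡ ys !! i) → xs ≡ ys
!!-extensionality [] [] eq = refl
!!-extensionality [] (y ∷ ys) eq with () ← eq 0
!!-extensionality (x ∷ xs) [] eq with () ← eq 0
!!-extensionality (x ∷ xs) (y ∷ ys) eq =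
  cong₂ _∷_ (just-injective (eq 0)) (!!-extensionality xs ys (eq ∘ suc))

!!-just⇒<length : (xs : List A) (i : ℕ) {x : A} → xs !! i ≡ just x → i ℕ.< length xs
!!-just⇒<length (x ∷ xs) zero eq = s≤s z≤n
!!-just⇒<length (x ∷ xs) (suc i) eq = s≤s (!!-just⇒<length xs i eq)

<length⇒!!-just : (xs : List A) (i : ℕ) → i ℕ.< length xs → ∃ λ x → xs !! i ≡ just x
<length⇒!!-just (x ∷ xs) zero lt = x , refl
<length⇒!!-just (x ∷ xs) (suc i) (s≤s lt) = <length⇒!!-just xs i lt

length≤⇒!!-nothing : (xs : List A) (i : ℕ) → length xs ℕ.≤ i → xs !! i ≡ nothing
length≤⇒!!-nothing [] i le = refl
length≤⇒!!-nothing (x ∷ xs) (suc i) (s≤s le) = length≤⇒!!-nothing xs i le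

!!-take-just : (n : ℕ) (xs : List A) (i : ℕ) {x : A} → take n xs !! i ≡ just x → xs !! i ≡ just x
!!-take-just (suc n) (x ∷ xs) zero eq = eq
!!-take-just (suc n) (x ∷ xs) (suc i) eq = !!-take-just n xs i eq

!!-take : (n : ℕ) (xs : List A) (i : ℕ) → i ℕ.< n → take n xs !! i ≡ xs !! i
!!-take (suc n) [] i lt = refl
!!-take (suc n) (x ∷ xs) zero lt = refl
!!-take (suc n) (x ∷ xs) (suc i) (s≤s lt) = !!-take n xs i lt

!!-upTo : (n i : ℕ) → i ℕ.< n → upTo n !! i ≡ just i
!!-upTo n i = go id n i
  where
  go : (f : ℕ → ℕ) (n i : ℕ) → i ℕ.< n → List.applyUpTo f n !! i ≡ just (f i)
  go f (suc n) zero lt = refl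
  go f (suc n) (suc i) (s≤s lt) = go (f ∘ suc) n i lt

upTo-!!-≥ : (n i : ℕ) → n ℕ.≤ i → upTo n !! i ≡ nothing
upTo-!!-≥ n i n≤i = length≤⇒!!-nothing (upTo n) i (subst (ℕ._≤ i) (sym (ListP.length-upTo n)) n≤i)

Maybe-map-just : (f : A → B) (m : Maybe A) {y : B} → Maybe.map f m ≡ just y →
  ∃ λ x → (m ≡ just x) × (f x ≡ y)
Maybe-map-just f (just x) refl = x , refl , refl

positive : ℕ → Bool
positive n = 0 <ᵇ n

nonEmpty⇒≢[] : (xs : List A) → nonEmpty xs ≡ true → xs ≢ []
nonEmpty⇒≢[] (x ∷ xs) _ ()

≢[]⇒nonEmpty : (xs : List A) → xs ≢ [] → nonEmpty xs ≡ true
≢[]⇒nonEmpty [] xs≢[] = contradiction refl xs≢[]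
≢[]⇒nonEmpty (x ∷ xs) _ = refl

¬nonEmpty⇒≡[] : (xs : List A) → nonEmpty xs ≡ false → xs ≡ []
¬nonEmpty⇒≡[] [] _ = refl

nonEmpty≡positive-length : (xs : List A) → nonEmpty xs ≡ positive (length xs)
nonEmpty≡positive-length [] = refl
nonEmpty≡positive-length (x ∷ xs) = refl

all≡true⇒All : (p : A → Bool) (xs : List A) → all p xs ≡ true → All (λ x → p x ≡ true) xs
all≡true⇒All p [] e = []
all≡true⇒All p (x ∷ xs) e with p x in px
... | true = px ∷ all≡true⇒All p xs e

All⇒all≡true : (p : A → Bool) (xs : List A) → All (λ x → p x ≡ true) xs → all p xs ≡ true
All⇒all≡true p [] [] = refl
All⇒all≡true p (x ∷ xs) (px ∷ pxs) rewrite px = All⇒all≡true p xs pxs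

length-filterᵇ-map : {p : A → Bool} {q : B → Bool} (f : A → B) → (∀ x → q (f x) ≡ p x) →
  ∀ xs → length (filterᵇ q (map f xs)) ≡ length (filterᵇ p xs)
length-filterᵇ-map f qf≡p [] = refl
length-filterᵇ-map {p = p} {q} f qf≡p (x ∷ xs) rewrite qf≡p x with p x
... | true = cong suc (length-filterᵇ-map f qf≡p xs)
... | false = length-filterᵇ-map f qf≡p xs

length-filterᵇ+length-filterᵇ-not : (p : A → Bool) (xs : List A) →
  length (filterᵇ p xs) + length (filterᵇ (not ∘ p) xs) ≡ length xs
length-filterᵇ+length-filterᵇ-not p [] = refl
length-filterᵇ+length-filterᵇ-not p (x ∷ xs) with p x
... | true = cong suc (length-filterᵇ+length-filterᵇ-not p xs)
... | false = trans (ℕP.+-suc _ _) (cong suc (length-filterᵇ+length-filterᵇ-not p xs))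

map-length-filterᵇ-nonEmpty : (xss : List (List A)) →
  map length (filterᵇ nonEmpty xss) ≡ filterᵇ positive (map length xss)
map-length-filterᵇ-nonEmpty [] = refl
map-length-filterᵇ-nonEmpty ([] ∷ xss) = map-length-filterᵇ-nonEmpty xss
map-length-filterᵇ-nonEmpty ((x ∷ xs) ∷ xss) = cong (suc (length xs) ∷_) (map-length-filterᵇ-nonEmpty xss)

-- Filtering a list whose selected positions form an initial segment

filterMaybe : (A → Bool) → Maybe A → Maybe A
filterMaybe p nothing = nothing
filterMaybe p (just x) = if p x then just x else nothing

filterMaybe-just : (p : A → Bool) (m : Maybe A) {x : A} →
  filterMaybe p m ≡ just x → (m ≡ just x) × (p x ≡ true)
filterMaybe-just p (just x) eq with p x in px
filterMaybe-just p (just x) refl | true = refl , px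

filterMaybe-accept : (p : A → Bool) {x : A} → p x ≡ true → filterMaybe p (just x) ≡ just x
filterMaybe-accept p px rewrite px = refl

filterMaybe-reject : (p : A → Bool) {x : A} → p x ≡ false → filterMaybe p (just x) ≡ nothing
filterMaybe-reject p px rewrite px = refl

>>=-filterMaybe-nonEmpty : (m : Maybe (List A)) (c : ℕ) →
  (filterMaybe nonEmpty m >>= (_!! c)) ≡ (m >>= (_!! c))
>>=-filterMaybe-nonEmpty nothing c = refl
>>=-filterMaybe-nonEmpty (just []) c = refl
>>=-filterMaybe-nonEmpty (just (x ∷ xs)) c = refl

PrefixClosed : (A → Bool) → List A → Set
PrefixClosed p xs = ∀ i {x y} → xs !! i ≡ just x → xs !! suc i ≡ just y → p y ≡ true → p x ≡ true

module _ (p : A → Bool) where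

  prefixClosed-∷-false : ∀ {x xs} → PrefixClosed p (x ∷ xs) → p x ≡ false →
    All (λ y → p y ≡ false) xs
  prefixClosed-∷-false {xs = []} pc px = []
  prefixClosed-∷-false {x} {z ∷ zs} pc px with p z in pz
  ... | true = contradiction (trans (sym (pc 0 refl refl pz)) px) λ ()
  ... | false = pz ∷ prefixClosed-∷-false (λ i → pc (suc i)) pz

  filterᵇ-none : ∀ {xs} → All (λ x → p x ≡ false) xs → filterᵇ p xs ≡ []
  filterᵇ-none = ListP.filter-none (T? ∘ p) ∘ All.map (subst T)

  filterᵇ-all : ∀ {xs} → All (λ x → p x ≡ true) xs → filterᵇ p xs ≡ xs
  filterᵇ-all = ListP.filter-all (T? ∘ p) ∘ All.map (Equivalence.from T-≡)

  filterMaybe-!!-none : ∀ {xs} → All (λ x → p x ≡ false) xs → ∀ i → filterMaybe p (xs !! i) ≡ nothing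
  filterMaybe-!!-none [] i = refl
  filterMaybe-!!-none (px ∷ pxs) zero = filterMaybe-reject p px
  filterMaybe-!!-none (px ∷ pxs) (suc i) = filterMaybe-!!-none pxs i

  filterᵇ-!!-prefix : ∀ xs → PrefixClosed p xs → ∀ i → filterᵇ p xs !! i ≡ filterMaybe p (xs !! i)
  filterᵇ-!!-prefix [] pc i = refl
  filterᵇ-!!-prefix (x ∷ xs) pc i with p x in px
  ... | true with i
  ...   | zero = sym (filterMaybe-accept p px)
  ...   | suc i = filterᵇ-!!-prefix xs (λ j → pc (suc j)) i
  filterᵇ-!!-prefix (x ∷ xs) pc i | false
    rewrite filterᵇ-none (prefixClosed-∷-false pc px) with i
  ...   | zero = sym (filterMaybe-reject p px)
  ...   | suc i = sym (filterMaybe-!!-none (prefixClosed-∷-false pc px) i)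

  prefixClosed⇒<length-filterᵇ : ∀ xs → PrefixClosed p xs → ∀ i {x} → xs !! i ≡ just x → p x ≡ true →
    i ℕ.< length (filterᵇ p xs)
  prefixClosed⇒<length-filterᵇ xs pc i {x} eq px = !!-just⇒<length (filterᵇ p xs) i (begin
    filterᵇ p xs !! i         ≡⟨ filterᵇ-!!-prefix xs pc i ⟩
    filterMaybe p (xs !! i)   ≡⟨ cong (filterMaybe p) eq ⟩
    filterMaybe p (just x)    ≡⟨ filterMaybe-accept p px ⟩
    just x                    ∎)
    where open ≡-Reasoning

  <length-filterᵇ⇒prefixClosed : ∀ xs → PrefixClosed p xs → ∀ i → i ℕ.< length (filterᵇ p xs) →
    ∃ λ x → (xs !! i ≡ just x) × (p x ≡ true)
  <length-filterᵇ⇒prefixClosed xs pc i lt with <length⇒!!-just (filterᵇ p xs) i lt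
  ... | x , eq = x , filterMaybe-just p (xs !! i) (trans (sym (filterᵇ-!!-prefix xs pc i)) eq)

filterᵇ-!!-suffix : (p : A → Bool) → ∀ xs → PrefixClosed (not ∘ p) xs → ∀ k →
  filterᵇ p xs !! k ≡ xs !! (k + length (filterᵇ (not ∘ p) xs))
filterᵇ-!!-suffix p [] pc k = refl
filterᵇ-!!-suffix p (x ∷ xs) pc k with p x in px
... | true
  rewrite filterᵇ-all p (All.map (λ e → trans (sym (not-involutive _)) (cong not e))
                               (prefixClosed-∷-false (not ∘ p) pc (cong not px)))
        | filterᵇ-none (not ∘ p) (prefixClosed-∷-false (not ∘ p) pc (cong not px))
        | ℕP.+-identityʳ k = refl
... | false rewrite ℕP.+-suc k (length (filterᵇ (not ∘ p) xs)) =
  filterᵇ-!!-suffix p xs (λ i → pc (suc i)) k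

prefixClosed-map : {p : A → Bool} {q : B → Bool} (f : A → B) → (∀ x → q (f x) ≡ p x) →
  ∀ xs → PrefixClosed p xs → PrefixClosed q (map f xs)
prefixClosed-map f qf≡p xs pc i ex ey qy
  with xs !! i in ex′ | xs !! suc i in ey′
     | trans (sym (!!-map f xs i)) ex | trans (sym (!!-map f xs (suc i))) ey
... | just x | just y | refl | refl = trans (qf≡p x) (pc i ex′ ey′ (trans (sym (qf≡p y)) qy))

prefixClosed-map⁻ : {q : B → Bool} (f : A → B) → ∀ xs → PrefixClosed q (map f xs) →
  PrefixClosed (q ∘ f) xs
prefixClosed-map⁻ f xs pc i ex ey =
  pc i (trans (!!-map f xs i) (cong (Maybe.map f) ex)) (trans (!!-map f xs (suc i)) (cong (Maybe.map f) ey))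

partAt≡fromMaybe : (xs : List ℕ) (i : ℕ) → partAt xs i ≡ fromMaybe 0 (xs !! i)
partAt≡fromMaybe [] i = refl
partAt≡fromMaybe (x ∷ xs) zero = refl
partAt≡fromMaybe (x ∷ xs) (suc i) = partAt≡fromMaybe xs i

length≤⇒partAt≡0 : (xs : List ℕ) (i : ℕ) → length xs ℕ.≤ i → partAt xs i ≡ 0
length≤⇒partAt≡0 [] i le = refl
length≤⇒partAt≡0 (x ∷ xs) (suc i) (s≤s le) = length≤⇒partAt≡0 xs i le

0<partAt⇒<length : (xs : List ℕ) (i : ℕ) → 0 ℕ.< partAt xs i → i ℕ.< length xs
0<partAt⇒<length (x ∷ xs) zero lt = s≤s z≤n
0<partAt⇒<length (x ∷ xs) (suc i) lt = s≤s (0<partAt⇒<length xs i lt)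

partAt-injective : (xs ys : List ℕ) → All (0 ℕ.<_) xs → All (0 ℕ.<_) ys →
  (∀ i → partAt xs i ≡ partAt ys i) → xs ≡ ys
partAt-injective [] [] _ _ eq = refl
partAt-injective [] (y ∷ ys) _ (py ∷ _) eq with refl ← eq 0 with () ← py
partAt-injective (x ∷ xs) [] (px ∷ _) _ eq with refl ← eq 0 with () ← px
partAt-injective (x ∷ xs) (y ∷ ys) (_ ∷ pxs) (_ ∷ pys) eq =
  cong₂ _∷_ (eq 0) (partAt-injective xs ys pxs pys (eq ∘ suc))

Decreasing : List ℕ → Set
Decreasing xs = ∀ i → partAt xs (suc i) ℕ.≤ partAt xs i

Decreasing⇒Linked : (xs : List ℕ) → Decreasing xs → Linked ℕ._≥_ xs
Decreasing⇒Linked [] dec = []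
Decreasing⇒Linked (x ∷ []) dec = [-]
Decreasing⇒Linked (x ∷ y ∷ ys) dec = dec 0 ∷ Decreasing⇒Linked (y ∷ ys) (dec ∘ suc)

Linked⇒Decreasing : (xs : List ℕ) → Linked ℕ._≥_ xs → Decreasing xs
Linked⇒Decreasing [] l i = z≤n
Linked⇒Decreasing (x ∷ []) l i = z≤n
Linked⇒Decreasing (x ∷ y ∷ ys) (x≥y ∷ l) zero = x≥y
Linked⇒Decreasing (x ∷ y ∷ ys) (x≥y ∷ l) (suc i) = Linked⇒Decreasing (y ∷ ys) l i

∀<⇒≤ : (m n : ℕ) → (∀ i → i ℕ.< m → i ℕ.< n) → m ℕ.≤ n
∀<⇒≤ zero n h = z≤n
∀<⇒≤ (suc m) n h = h m ℕP.≤-refl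

decreasing⇒prefixClosed-positive : (xs : List ℕ) → Decreasing xs → PrefixClosed positive xs
decreasing⇒prefixClosed-positive xs dec i ex ey = positive-mono (subst₂ ℕ._≤_
  (trans (partAt≡fromMaybe xs (suc i)) (cong (fromMaybe 0) ey))
  (trans (partAt≡fromMaybe xs i) (cong (fromMaybe 0) ex))
  (dec i))
  where
  positive-mono : ∀ {x y} → y ℕ.≤ x → positive y ≡ true → positive x ≡ true
  positive-mono {suc x} _ _ = refl
  positive-mono {zero} {suc y} () _

partAt-filterᵇ-positive : (xs : List ℕ) → Decreasing xs → ∀ i →
  partAt (filterᵇ positive xs) i ≡ partAt xs i
partAt-filterᵇ-positive xs dec i = begin
  partAt (filterᵇ positive xs) i              ≡⟨ partAt≡fromMaybe (filterᵇ positive xs) i ⟩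
  fromMaybe 0 (filterᵇ positive xs !! i)      ≡⟨ cong (fromMaybe 0) (filterᵇ-!!-prefix positive xs
                                                   (decreasing⇒prefixClosed-positive xs dec) i) ⟩
  fromMaybe 0 (filterMaybe positive (xs !! i)) ≡⟨ dropZero (xs !! i) ⟩
  fromMaybe 0 (xs !! i)                       ≡⟨ partAt≡fromMaybe xs i ⟨
  partAt xs i                                 ∎
  where
  open ≡-Reasoning
  dropZero : (m : Maybe ℕ) → fromMaybe 0 (filterMaybe positive m) ≡ fromMaybe 0 m
  dropZero nothing = refl
  dropZero (just zero) = refl
  dropZero (just (suc n)) = refl

filterᵇ-positive-isPartition : (xs : List ℕ) → Decreasing xs → IsPartition (filterᵇ positive xs)
filterᵇ-positive-isPartition xs dec =
  Decreasing⇒Linked _ (λ i → subst₂ ℕ._≤_ (sym (partAt-filterᵇ-positive xs dec (suc i)))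
                                           (sym (partAt-filterᵇ-positive xs dec i)) (dec i)) ,
  All.map (ℕP.<ᵇ⇒< 0 _) (AllP.all-filter (T? ∘ positive) xs)

isNonPos⇒≤0 : {x : ℤ} → isNonPos x ≡ true → x ℤ.≤ 0ℤ
isNonPos⇒≤0 = ℤP.≤ᵇ⇒≤ ∘ Equivalence.from T-≡

≤0⇒isNonPos : {x : ℤ} → x ℤ.≤ 0ℤ → isNonPos x ≡ true
≤0⇒isNonPos = Equivalence.to T-≡ ∘ ℤP.≤⇒≤ᵇ

¬isNonPos⇒0< : {x : ℤ} → isNonPos x ≡ false → 0ℤ ℤ.< x
¬isNonPos⇒0< e = ℤP.≰⇒> (λ x≤0 → contradiction (trans (sym (≤0⇒isNonPos x≤0)) e) λ ())

0<⇒¬isNonPos : {x : ℤ} → 0ℤ ℤ.< x → isNonPos x ≡ false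
0<⇒¬isNonPos {x} 0<x with isNonPos x in e
... | false = refl
... | true = contradiction (isNonPos⇒≤0 e) (ℤP.<⇒≱ 0<x)

isPos⇒0< : {x : ℤ} → isPos x ≡ true → 0ℤ ℤ.< x
isPos⇒0< {x} e with isNonPos x in e′
... | false = ¬isNonPos⇒0< e′

0<⇒isPos : {x : ℤ} → 0ℤ ℤ.< x → isPos x ≡ true
0<⇒isPos 0<x = cong not (0<⇒¬isNonPos 0<x)

0<x≤b⊔0⇒x≤b : {x b : ℤ} → 0ℤ ℤ.< x → x ℤ.≤ b ⊔ 0ℤ → x ℤ.≤ b
0<x≤b⊔0⇒x≤b {x} {b} 0<x x≤b⊔0 with ℤP.≤-total b 0ℤ
... | inj₁ b≤0 = contradiction (subst (x ℤ.≤_) (ℤP.i≤j⇒i⊔j≡j b≤0) x≤b⊔0) (ℤP.<⇒≱ 0<x)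
... | inj₂ 0≤b = subst (x ℤ.≤_) (ℤP.i≥j⇒i⊔j≡i 0≤b) x≤b⊔0

All₂ : (ℤ → ℤ → Set) → FinSet → FinSet → Set
All₂ R X Y = All (λ x → All (R x) Y) X

All₂-<⇒≤ : {X Y : FinSet} → All₂ ℤ._<_ X Y → All₂ ℤ._≤_ X Y
All₂-<⇒≤ = All.map (All.map ℤP.<⇒≤)

All₂-filterᵇ : {R : ℤ → ℤ → Set} (p q : ℤ → Bool) {X Y : FinSet} → All₂ R X Y →
  All₂ R (filterᵇ p X) (filterᵇ q Y)
All₂-filterᵇ p q = AllP.filter⁺ (T? ∘ p) ∘ All.map (AllP.filter⁺ (T? ∘ q))

negValues posValues : FinSet → FinSet
negValues = filterᵇ isNonPos
posValues = filterᵇ isPos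

nonEmpty-negValues : (X : FinSet) → nonEmpty (negValues X) ≡ any isNonPos X
nonEmpty-negValues [] = refl
nonEmpty-negValues (x ∷ X) with isNonPos x
... | true = refl
... | false = nonEmpty-negValues X

not-nonEmpty-posValues : (X : FinSet) → not (nonEmpty (posValues X)) ≡ all isNonPos X
not-nonEmpty-posValues [] = refl
not-nonEmpty-posValues (x ∷ X) with isNonPos x
... | true = not-nonEmpty-posValues X
... | false = refl

positive-head⇒All-positive : {x : ℤ} (X : FinSet) → 0ℤ ℤ.< x → Linked ℤ._<_ (x ∷ X) →
  All (0ℤ ℤ.<_) X
positive-head⇒All-positive [] _ _ = []
positive-head⇒All-positive (y ∷ Y) 0<x (x<y ∷ sorted) =
  All.map (ℤP.<-trans 0<x) (LinkedP.Linked⇒All ℤP.<-trans x<y sorted)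

negValues++posValues : (X : FinSet) → Linked ℤ._<_ X → negValues X ++ posValues X ≡ X
negValues++posValues [] _ = refl
negValues++posValues (x ∷ X) sorted with isNonPos x in e
... | true = cong (x ∷_) (negValues++posValues X (Linked.tail sorted))
... | false
  rewrite filterᵇ-none isNonPos (All.map 0<⇒¬isNonPos (positive-head⇒All-positive X (¬isNonPos⇒0< e) sorted))
        | filterᵇ-all isPos (All.map 0<⇒isPos (positive-head⇒All-positive X (¬isNonPos⇒0< e) sorted))
        = refl

negValues-nonPos : (X : FinSet) → All (ℤ._≤ 0ℤ) (negValues X)
negValues-nonPos X = All.map ℤP.≤ᵇ⇒≤ (AllP.all-filter (T? ∘ isNonPos) X)

posValues-pos : (X : FinSet) → All (0ℤ ℤ.<_) (posValues X)
posValues-pos X = All.map (isPos⇒0< ∘ Equivalence.to T-≡) (AllP.all-filter (T? ∘ isPos) X)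

all⇒any : (X : FinSet) → X ≢ [] → all isNonPos X ≡ true → any isNonPos X ≡ true
all⇒any [] X≢[] _ = contradiction refl X≢[]
all⇒any (x ∷ X) _ e with isNonPos x
... | true = refl

allNonPos-below-anyNonPos : (X Y : FinSet) → All₂ ℤ._≤_ X Y → any isNonPos Y ≡ true →
  all isNonPos X ≡ true
allNonPos-below-anyNonPos X Y X≤Y anyY =
  All⇒all≡true isNonPos X (All.map (λ x≤Y → ≤0⇒isNonPos (below Y x≤Y anyY)) X≤Y)
  where
  below : ∀ {x} (Y : FinSet) → All (x ℤ.≤_) Y → any isNonPos Y ≡ true → x ℤ.≤ 0ℤ
  below (y ∷ Y) (x≤y ∷ x≤Y) with isNonPos y in e
  ... | true = λ _ → ℤP.≤-trans x≤y (isNonPos⇒≤0 e)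
  ... | false = below Y x≤Y

Linked-++ : {R : A → A → Set} (xs ys : List A) → Linked R xs → Linked R ys →
  All (λ x → All (R x) ys) xs → Linked R (xs ++ ys)
Linked-++ [] ys _ sorted-ys _ = sorted-ys
Linked-++ (x ∷ []) [] _ _ _ = [-]
Linked-++ (x ∷ []) (y ∷ ys) _ sorted-ys ((Rxy ∷ _) ∷ []) = Rxy ∷ sorted-ys
Linked-++ (x ∷ x′ ∷ xs) ys (Rxx′ ∷ sorted-xs) sorted-ys (_ ∷ R-xs-ys) =
  Rxx′ ∷ Linked-++ (x′ ∷ xs) ys sorted-xs sorted-ys R-xs-ys

All₂-++ : {R : ℤ → ℤ → Set} {A B C D : FinSet} →
  All₂ R A C → All₂ R A D → All₂ R B C → All₂ R B D → All₂ R (A ++ B) (C ++ D)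
All₂-++ AC AD BC BD =
  AllP.++⁺ (All.zipWith (λ (ac , ad) → AllP.++⁺ ac ad) (AC , AD))
           (All.zipWith (λ (bc , bd) → AllP.++⁺ bc bd) (BC , BD))

sign⇒All₂ : {R : ℤ → ℤ → Set} → (∀ {x y} → x ℤ.≤ 0ℤ → 0ℤ ℤ.< y → R x y) →
  {A B : FinSet} → All (ℤ._≤ 0ℤ) A → All (0ℤ ℤ.<_) B → All₂ R A B
sign⇒All₂ R-sign A≤0 0<B = All.map (λ x≤0 → All.map (R-sign x≤0) 0<B) A≤0

NonPosEntry PosEntry : FinSet → Set
NonPosEntry X = IsEntry X × All (ℤ._≤ 0ℤ) X
PosEntry X = IsEntry X × All (0ℤ ℤ.<_) X

NonPosEntry⇒allNonPos : {A : FinSet} → NonPosEntry A → all isNonPos A ≡ true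
NonPosEntry⇒allNonPos (_ , A≤0) = All⇒all≡true isNonPos _ (All.map ≤0⇒isNonPos A≤0)

mergeCells : Maybe FinSet → Maybe FinSet → Maybe FinSet
mergeCells nothing m = m
mergeCells (just X) nothing = just X
mergeCells (just X) (just Y) = just (X ++ Y)

flat : Maybe FinSet → FinSet
flat = fromMaybe []

flat-just : (m : Maybe FinSet) {X : FinSet} → m ≡ just X → just (flat m) ≡ m
flat-just (just X) refl = refl

mergeCells-justˡ : (A : FinSet) (u : Maybe FinSet) → ∃ λ X → mergeCells (just A) u ≡ just X
mergeCells-justˡ A nothing = A , refl
mergeCells-justˡ A (just B) = A ++ B , refl

mergeCells-justʳ : (s : Maybe FinSet) (B : FinSet) → ∃ λ X → mergeCells s (just B) ≡ just X
mergeCells-justʳ nothing B = B , refl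
mergeCells-justʳ (just A) B = A ++ B , refl

mergeCells-just : (s u : Maybe FinSet) {X : FinSet} → mergeCells s u ≡ just X → X ≡ flat s ++ flat u
mergeCells-just nothing (just Y) refl = refl
mergeCells-just (just X) nothing refl = sym (ListP.++-identityʳ X)
mergeCells-just (just X) (just Y) refl = refl

All₂-flat : {R : ℤ → ℤ → Set} (s t : Maybe FinSet) →
  (∀ {A B} → s ≡ just A → t ≡ just B → All₂ R A B) → All₂ R (flat s) (flat t)
All₂-flat nothing t R-st = []
All₂-flat (just A) nothing R-st = All.map (λ _ → []) (All.universal (λ _ → tt) A)
All₂-flat (just A) (just B) R-st = R-st refl refl

All₁-flat : {P : ℤ → Set} (m : Maybe FinSet) → (∀ {A} → m ≡ just A → All P A) → All P (flat m)
All₁-flat nothing P-m = []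
All₁-flat (just A) P-m = P-m refl

mergeCells-split : (m : Maybe FinSet) → MaybeAll (Linked ℤ._<_) m →
  m ≡ mergeCells (filterMaybe nonEmpty (Maybe.map negValues m)) (Maybe.map posValues m)
mergeCells-split nothing _ = refl
mergeCells-split (just X) (just sorted) with nonEmpty (negValues X) in e
... | true = cong just (sym (negValues++posValues X sorted))
... | false =
  cong just (sym (trans (cong (_++ posValues X) (sym (¬nonEmpty⇒≡[] _ e))) (negValues++posValues X sorted)))

mergeCells-IsEntry : {s u : Maybe FinSet} → MaybeAll NonPosEntry s → MaybeAll PosEntry u →
  MaybeAll IsEntry (mergeCells s u)
mergeCells-IsEntry nothing nothing = nothing
mergeCells-IsEntry nothing (just (Y-entry , _)) = just Y-entry
mergeCells-IsEntry (just (X-entry , _)) nothing = just X-entry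
mergeCells-IsEntry (just ((X≢[] , sorted-X) , X≤0)) (just ((_ , sorted-Y) , 0<Y)) =
  just ((λ X++Y≡[] → X≢[] (ListP.++-conicalˡ _ _ X++Y≡[])) ,
        Linked-++ _ _ sorted-X sorted-Y (sign⇒All₂ ℤP.≤-<-trans X≤0 0<Y))

negValues-mergeCells : {s u : Maybe FinSet} → MaybeAll NonPosEntry s → MaybeAll PosEntry u →
  filterMaybe nonEmpty (Maybe.map negValues (mergeCells s u)) ≡ s
negValues-mergeCells nothing nothing = refl
negValues-mergeCells nothing (just (_ , 0<Y))
  rewrite filterᵇ-none isNonPos (All.map 0<⇒¬isNonPos 0<Y) = refl
negValues-mergeCells (just {X} ((X≢[] , _) , X≤0)) nothing
  rewrite filterᵇ-all isNonPos (All.map ≤0⇒isNonPos X≤0)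
  = filterMaybe-accept nonEmpty (≢[]⇒nonEmpty X X≢[])
negValues-mergeCells (just {X} ((X≢[] , _) , X≤0)) (just {Y} (_ , 0<Y))
  rewrite ListP.filter-++ (T? ∘ isNonPos) X Y
        | filterᵇ-all isNonPos (All.map ≤0⇒isNonPos X≤0)
        | filterᵇ-none isNonPos (All.map 0<⇒¬isNonPos 0<Y)
        | ListP.++-identityʳ X = filterMaybe-accept nonEmpty (≢[]⇒nonEmpty X X≢[])

posValues-mergeCells : {s : Maybe FinSet} {Y : FinSet} → MaybeAll NonPosEntry s → All (0ℤ ℤ.<_) Y →
  Maybe.map posValues (mergeCells s (just Y)) ≡ just Y
posValues-mergeCells nothing 0<Y rewrite filterᵇ-all isPos (All.map 0<⇒isPos 0<Y) = refl
posValues-mergeCells {Y = Y} (just {X} (_ , X≤0)) 0<Y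
  rewrite ListP.filter-++ (T? ∘ isPos) X Y
        | filterᵇ-none isPos (All.map (cong not ∘ ≤0⇒isNonPos) X≤0)
        | filterᵇ-all isPos (All.map 0<⇒isPos 0<Y) = refl

anyNonPos-mergeCells : (s u : Maybe FinSet) → MaybeAll PosEntry u → ∀ {X} →
  mergeCells s u ≡ just X → any isNonPos X ≡ true → ∃ λ A → s ≡ just A
anyNonPos-mergeCells (just A) u _ _ _ = A , refl
anyNonPos-mergeCells nothing (just Y) (just (_ , 0<Y)) refl anyY =
  contradiction (trans (sym anyY) (noneNonPos Y 0<Y)) λ ()
  where
  noneNonPos : (Y : FinSet) → All (0ℤ ℤ.<_) Y → any isNonPos Y ≡ false
  noneNonPos [] [] = refl
  noneNonPos (y ∷ Y) (0<y ∷ 0<Y) rewrite 0<⇒¬isNonPos 0<y = noneNonPos Y 0<Y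

allNonPos-mergeCells : (s u : Maybe FinSet) → MaybeAll PosEntry u → ∀ {X} →
  mergeCells s u ≡ just X → all isNonPos X ≡ true → u ≡ nothing
allNonPos-mergeCells s nothing _ _ _ = refl
allNonPos-mergeCells s (just []) (just ((Y≢[] , _) , _)) _ _ = contradiction refl Y≢[]
allNonPos-mergeCells s (just (y ∷ Y)) (just (_ , 0<y ∷ _)) {X} eX allX =
  contradiction (trans (sym y-nonPos) (0<⇒¬isNonPos 0<y)) λ ()
  where
  y-nonPos : isNonPos y ≡ true
  y-nonPos = All.head (AllP.++⁻ʳ (flat s)
    (subst (All (λ x → isNonPos x ≡ true)) (mergeCells-just s (just (y ∷ Y)) eX)
           (all≡true⇒All isNonPos X allX)))

mergeCells-anyNonPos : (A : FinSet) (u : Maybe FinSet) → NonPosEntry A →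
  ∃ λ X → (mergeCells (just A) u ≡ just X) × (any isNonPos X ≡ true)
mergeCells-anyNonPos [] u ((A≢[] , _) , _) = contradiction refl A≢[]
mergeCells-anyNonPos (a ∷ A) nothing (_ , a≤0 ∷ _) =
  a ∷ A , refl , cong (_∨ any isNonPos A) (≤0⇒isNonPos a≤0)
mergeCells-anyNonPos (a ∷ A) (just B) (_ , a≤0 ∷ _) =
  a ∷ A ++ B , refl , cong (_∨ any isNonPos (A ++ B)) (≤0⇒isNonPos a≤0)

cell-nothing-row : (ρ : List ℕ) (U : Tab) (r c : ℕ) → U !! r ≡ nothing → cell ρ U r c ≡ nothing
cell-nothing-row ρ U r c e rewrite e = refl

cell-left : (ρ : List ℕ) (U : Tab) (r c : ℕ) → c ℕ.< partAt ρ r → cell ρ U r c ≡ nothing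
cell-left ρ U r c c<ρ with U !! r
... | nothing = refl
... | just row rewrite Equivalence.to T-≡ (ℕP.<⇒<ᵇ c<ρ) = refl

cell-right : (ρ : List ℕ) (U : Tab) (r c : ℕ) {row : List FinSet} → U !! r ≡ just row →
  partAt ρ r ℕ.≤ c → cell ρ U r c ≡ row !! (c ∸ partAt ρ r)
cell-right ρ U r c e ρ≤c rewrite e with c <ᵇ partAt ρ r in lt
... | false = refl
... | true = contradiction ρ≤c (ℕP.<⇒≱ (ℕP.<ᵇ⇒< c _ (Equivalence.from T-≡ lt)))

cell-[] : (U : Tab) (r c : ℕ) → cell [] U r c ≡ (U !! r >>= (_!! c))
cell-[] U r c with U !! r
... | nothing = refl
... | just row = refl

cell-straight : (U : Tab) (r c : ℕ) {row : List FinSet} → U !! r ≡ just row → cell [] U r c ≡ row !! c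
cell-straight U r c e = trans (cell-[] U r c) (cong (_>>= (_!! c)) e)

cell-just⇒row : (ρ : List ℕ) (U : Tab) (r c : ℕ) {X : FinSet} → cell ρ U r c ≡ just X →
  ∃ λ row → U !! r ≡ just row
cell-just⇒row ρ U r c e with U !! r
... | just row = row , refl

cell-extensionality : (ρ : List ℕ) (U V : Tab) → length U ≡ length V →
  (∀ r c → cell ρ U r c ≡ cell ρ V r c) → U ≡ V
cell-extensionality ρ U V len eq = !!-extensionality U V rows
  where
  rowEq : ∀ r {rowU rowV} → U !! r ≡ just rowU → V !! r ≡ just rowV → rowU ≡ rowV
  rowEq r {rowU} {rowV} eU eV = !!-extensionality rowU rowV λ k → begin
    rowU !! k                        ≡⟨ cong (rowU !!_) (ℕP.m+n∸n≡m k ρr) ⟨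
    rowU !! (k + ρr ∸ ρr)            ≡⟨ cell-right ρ U r (k + ρr) eU (ℕP.m≤n+m ρr k) ⟨
    cell ρ U r (k + ρr)              ≡⟨ eq r (k + ρr) ⟩
    cell ρ V r (k + ρr)              ≡⟨ cell-right ρ V r (k + ρr) eV (ℕP.m≤n+m ρr k) ⟩
    rowV !! (k + ρr ∸ ρr)            ≡⟨ cong (rowV !!_) (ℕP.m+n∸n≡m k ρr) ⟩
    rowV !! k                        ∎
    where
    open ≡-Reasoning
    ρr : ℕ
    ρr = partAt ρ r
  rows : ∀ r → U !! r ≡ V !! r
  rows r with U !! r in eU | V !! r in eV
  ... | nothing | nothing = refl
  ... | just rowU | just rowV = cong just (rowEq r eU eV)
  ... | just _ | nothing =
    contradiction (trans (sym eV) (proj₂ (<length⇒!!-just V r (subst (r ℕ.<_) len (!!-just⇒<length U r eU)))))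
      λ ()
  ... | nothing | just _ =
    contradiction (trans (sym eU) (proj₂ (<length⇒!!-just U r (subst (r ℕ.<_) (sym len) (!!-just⇒<length V r eV)))))
      λ ()

module SkewShape {ψ : List ℤ} {κ ρ : List ℕ} {U : Tab} (H : IsSSYT ψ κ ρ U) where
  open IsSSYT H

  cell-just⇒InSkew : ∀ r c {X} → cell ρ U r c ≡ just X → InSkew κ ρ r c
  cell-just⇒InSkew r c {X} e with cell-just⇒row ρ U r c e
  ... | row , eU = ρ≤c , c<κ
    where
    ρ≤c : partAt ρ r ℕ.≤ c
    ρ≤c = ℕP.≮⇒≥ λ c<ρ → contradiction (trans (sym e) (cell-left ρ U r c c<ρ)) λ ()
    c<κ : c ℕ.< partAt κ r
    c<κ = ℕP.≰⇒> λ κ≤c → ℕP.<⇒≱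
      (subst (c ∸ partAt ρ r ℕ.<_) (rowLen r row eU)
             (!!-just⇒<length row _ (trans (sym (cell-right ρ U r c eU ρ≤c)) e)))
      (ℕP.∸-monoˡ-≤ (partAt ρ r) κ≤c)

  InSkew⇒cell-just : ∀ r c → InSkew κ ρ r c → ∃ λ X → cell ρ U r c ≡ just X
  InSkew⇒cell-just r c (ρ≤c , c<κ)
    with <length⇒!!-just U r (subst (r ℕ.<_) (sym nrows) (0<partAt⇒<length κ r (ℕP.≤-<-trans z≤n c<κ)))
  ... | row , eU
    with <length⇒!!-just row (c ∸ partAt ρ r)
           (subst (c ∸ partAt ρ r ℕ.<_) (sym (rowLen r row eU)) (ℕP.∸-monoˡ-< c<κ ρ≤c))
  ...   | X , eX = X , trans (cell-right ρ U r c eU ρ≤c) eX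

  ¬InSkew⇒cell-nothing : ∀ r c → ¬ InSkew κ ρ r c → cell ρ U r c ≡ nothing
  ¬InSkew⇒cell-nothing r c ¬in with cell ρ U r c in e
  ... | nothing = refl
  ... | just X = contradiction (cell-just⇒InSkew r c e) ¬in

recombinedCell : Split → ℕ → ℕ → Maybe FinSet
recombinedCell (split ν S μ U) r c = mergeCells (cell [] S r c) (cell μ U r c)

cntRow : (FinSet → Bool) → List FinSet → ℕ
cntRow p row = length (filterᵇ p row)

negRow posRow : List FinSet → List FinSet
negRow row = filterᵇ nonEmpty (map negValues row)
posRow row = filterᵇ nonEmpty (map posValues row)

length-negRow : (row : List FinSet) → length (negRow row) ≡ cntRow (any isNonPos) row
length-negRow = length-filterᵇ-map negValues nonEmpty-negValues

length-posRow : (row : List FinSet) → length (posRow row) + cntRow (all isNonPos) row ≡ length row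
length-posRow row = begin
  length (posRow row) + cntRow (all isNonPos) row
    ≡⟨ cong (length (posRow row) +_) (length-filterᵇ-map posValues not-nonEmpty-posValues row) ⟨
  length (posRow row) + length (filterᵇ (not ∘ nonEmpty) (map posValues row))
    ≡⟨ length-filterᵇ+length-filterᵇ-not nonEmpty (map posValues row) ⟩
  length (map posValues row)
    ≡⟨ ListP.length-map posValues row ⟩
  length row ∎
  where open ≡-Reasoning

-- Splitting a tableau

module Decomposition {φ : List ℤ} {λ′ : List ℕ} (λ-partition : IsPartition λ′)
                     {T : Tab} (T-ssyt : IsSSYT φ λ′ [] T) where
  open IsSSYT T-ssyt
  open SkewShape T-ssyt

  count : (FinSet → Bool) → ℕ → ℕ
  count p = partAt (map (cntRow p) T)

  count-!! : ∀ p r → count p r ≡ fromMaybe 0 (Maybe.map (cntRow p) (T !! r))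
  count-!! p r = trans (partAt≡fromMaybe (map (cntRow p) T) r) (cong (fromMaybe 0) (!!-map (cntRow p) T r))

  count-row : ∀ p r {row} → T !! r ≡ just row → count p r ≡ cntRow p row
  count-row p r e = trans (count-!! p r) (cong (fromMaybe 0 ∘ Maybe.map (cntRow p)) e)

  count-nothing : ∀ p r → T !! r ≡ nothing → count p r ≡ 0
  count-nothing p r e = trans (count-!! p r) (cong (fromMaybe 0 ∘ Maybe.map (cntRow p)) e)

  cell-above : ∀ r c {Y} → cell [] T (suc r) c ≡ just Y → ∃ λ X → cell [] T r c ≡ just X
  cell-above r c eY = InSkew⇒cell-just r c
    (z≤n , ℕP.<-≤-trans (proj₂ (cell-just⇒InSkew (suc r) c eY))
                        (Linked⇒Decreasing λ′ (proj₁ λ-partition) r))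

  cell-nonEmpty : ∀ r c {X} → cell [] T r c ≡ just X → X ≢ []
  cell-nonEmpty r c e = proj₁ (entries r c _ e)

  cell-sorted : ∀ r c → MaybeAll (Linked ℤ._<_) (cell [] T r c)
  cell-sorted r c with cell [] T r c in e
  ... | nothing = nothing
  ... | just X = just (proj₂ (entries r c X e))

  rowWeak-straight : ∀ r {row} → T !! r ≡ just row → ∀ c {X Y} →
    row !! c ≡ just X → row !! suc c ≡ just Y → All₂ ℤ._≤_ X Y
  rowWeak-straight r e c eX eY =
    rowWeak r c _ _ (trans (cell-straight T r c e) eX) (trans (cell-straight T r (suc c) e) eY)

  nonEmpty-straight : ∀ r {row} → T !! r ≡ just row → ∀ c {X} → row !! c ≡ just X → X ≢ []
  nonEmpty-straight r e c eX = cell-nonEmpty r c (trans (cell-straight T r c e) eX)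

  prefixClosed-anyNonPos : ∀ r {row} → T !! r ≡ just row → PrefixClosed (any isNonPos) row
  prefixClosed-anyNonPos r e c eX eY anyY = all⇒any _ (nonEmpty-straight r e c eX)
    (allNonPos-below-anyNonPos _ _ (rowWeak-straight r e c eX eY) anyY)

  prefixClosed-allNonPos : ∀ r {row} → T !! r ≡ just row → PrefixClosed (all isNonPos) row
  prefixClosed-allNonPos r e c eX eY allY = allNonPos-below-anyNonPos _ _ (rowWeak-straight r e c eX eY)
    (all⇒any _ (nonEmpty-straight r e (suc c) eY) allY)

  module Counting (p : FinSet → Bool) (pc : ∀ r {row} → T !! r ≡ just row → PrefixClosed p row) where

    <count⇒cell : ∀ r c → c ℕ.< count p r → ∃ λ X → (cell [] T r c ≡ just X) × (p X ≡ true)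
    <count⇒cell r c c<count with T !! r in e
    ... | nothing = contradiction (subst (c ℕ.<_) (count-nothing p r e) c<count) ℕP.n≮0
    ... | just row = <length-filterᵇ⇒prefixClosed p row (pc r e) c (subst (c ℕ.<_) (count-row p r e) c<count)

    cell⇒<count : ∀ r c {X} → cell [] T r c ≡ just X → p X ≡ true → c ℕ.< count p r
    cell⇒<count r c eX pX with cell-just⇒row [] T r c eX
    ... | row , e = subst (c ℕ.<_) (sym (count-row p r e))
      (prefixClosed⇒<length-filterᵇ p row (pc r e) c (trans (sym (cell-straight T r c e)) eX) pX)

  νRow μRow : ℕ → ℕ
  νRow = count (any isNonPos)
  μRow = count (all isNonPos)

  open Counting (any isNonPos) prefixClosed-anyNonPos public
    renaming (<count⇒cell to <νRow⇒cell; cell⇒<count to cell⇒<νRow)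
  open Counting (all isNonPos) prefixClosed-allNonPos public
    renaming (<count⇒cell to <μRow⇒cell; cell⇒<count to cell⇒<μRow)

  νRow-decreasing : Decreasing (map (cntRow (any isNonPos)) T)
  νRow-decreasing r = ∀<⇒≤ _ _ anyNonPos-upward
    where
    anyNonPos-upward : ∀ c → c ℕ.< νRow (suc r) → c ℕ.< νRow r
    anyNonPos-upward c c<ν′ with <νRow⇒cell (suc r) c c<ν′
    ... | Y , eY , anyY with cell-above r c eY
    ...   | X , eX = cell⇒<νRow r c eX (all⇒any X (cell-nonEmpty r c eX)
                       (allNonPos-below-anyNonPos X Y (All₂-<⇒≤ (colStrict r c X Y eX eY)) anyY))

  μRow-decreasing : Decreasing (map (cntRow (all isNonPos)) T)
  μRow-decreasing r = ∀<⇒≤ _ _ allNonPos-upward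
    where
    allNonPos-upward : ∀ c → c ℕ.< μRow (suc r) → c ℕ.< μRow r
    allNonPos-upward c c<μ′ with <μRow⇒cell (suc r) c c<μ′
    ... | Y , eY , allY with cell-above r c eY
    ...   | X , eX = cell⇒<μRow r c eX (allNonPos-below-anyNonPos X Y (All₂-<⇒≤ (colStrict r c X Y eX eY))
                       (all⇒any Y (cell-nonEmpty (suc r) c eY) allY))

  μRow≤νRow : ∀ r → μRow r ℕ.≤ νRow r
  μRow≤νRow r = ∀<⇒≤ _ _ λ c c<μ → case <μRow⇒cell r c c<μ of λ where
    (X , eX , allX) → cell⇒<νRow r c eX (all⇒any X (cell-nonEmpty r c eX) allX)

  νRow≤λ : ∀ r → νRow r ℕ.≤ partAt λ′ r
  νRow≤λ r = ∀<⇒≤ _ _ λ c c<ν →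
    proj₂ (cell-just⇒InSkew r c (proj₁ (proj₂ (<νRow⇒cell r c c<ν))))

  ν μ : List ℕ
  ν = nuShape T
  μ = muShape T

  ν-at : ∀ r → partAt ν r ≡ νRow r
  ν-at = partAt-filterᵇ-positive (map (cntRow (any isNonPos)) T) νRow-decreasing

  μ-at : ∀ r → partAt μ r ≡ μRow r
  μ-at = partAt-filterᵇ-positive (map (cntRow (all isNonPos)) T) μRow-decreasing

  ν-partition : IsPartition ν
  ν-partition = filterᵇ-positive-isPartition (map (cntRow (any isNonPos)) T) νRow-decreasing

  μ-partition : IsPartition μ
  μ-partition = filterᵇ-positive-isPartition (map (cntRow (all isNonPos)) T) μRow-decreasing

  ν⊆λ : ν ⊆ₚ λ′
  ν⊆λ r = subst (ℕ._≤ partAt λ′ r) (sym (ν-at r)) (νRow≤λ r)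

  μ⊆ν : μ ⊆ₚ ν
  μ⊆ν r = subst₂ ℕ._≤_ (sym (μ-at r)) (sym (ν-at r)) (μRow≤νRow r)

  -- a cell of ν/μ holds a positive value, so no neighbour to its right or below
  -- can hold a non-positive one
  ν/μ-disconnected : Disconnected ν μ
  ν/μ-disconnected r c (μ≤c , c<ν) = case <νRow⇒cell r c (subst (c ℕ.<_) (ν-at r) c<ν) of λ where
    (X , eX , _) →
      let ¬allX : all isNonPos X ≡ true → ⊥
          ¬allX allX = ℕP.<⇒≱ (cell⇒<μRow r c eX allX) (subst (ℕ._≤ c) (μ-at r) μ≤c)
      in (λ (_ , c+1<ν) → case <νRow⇒cell r (suc c) (subst (suc c ℕ.<_) (ν-at r) c+1<ν) of λ where
            (Y , eY , anyY) → ¬allX (allNonPos-below-anyNonPos X Y (rowWeak r c X Y eX eY) anyY)) ,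
         (λ (_ , c<ν′) → case <νRow⇒cell (suc r) c (subst (c ℕ.<_) (ν-at (suc r)) c<ν′) of λ where
            (Y , eY , anyY) → ¬allX (allNonPos-below-anyNonPos X Y (All₂-<⇒≤ (colStrict r c X Y eX eY)) anyY))

  negRows-prefixClosed : PrefixClosed nonEmpty (map negRow T)
  negRows-prefixClosed = prefixClosed-map negRow
    (λ row → trans (nonEmpty≡positive-length (negRow row)) (cong positive (length-negRow row)))
    T (prefixClosed-map⁻ (cntRow (any isNonPos)) T
         (decreasing⇒prefixClosed-positive (map (cntRow (any isNonPos)) T) νRow-decreasing))

  negRow-!! : ∀ r {row} → T !! r ≡ just row → ∀ c →
    negRow row !! c ≡ filterMaybe nonEmpty (Maybe.map negValues (row !! c))
  negRow-!! r {row} e c = trans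
    (filterᵇ-!!-prefix nonEmpty (map negValues row)
       (prefixClosed-map negValues nonEmpty-negValues row (prefixClosed-anyNonPos r e)) c)
    (cong (filterMaybe nonEmpty) (!!-map negValues row c))

  cell-negPart : ∀ r c → cell [] (negPart T) r c ≡ filterMaybe nonEmpty (Maybe.map negValues (cell [] T r c))
  cell-negPart r c = begin
    cell [] (negPart T) r c
      ≡⟨ cell-[] (negPart T) r c ⟩
    (negPart T !! r >>= (_!! c))
      ≡⟨ cong (_>>= (_!! c)) (filterᵇ-!!-prefix nonEmpty (map negRow T) negRows-prefixClosed r) ⟩
    (filterMaybe nonEmpty (map negRow T !! r) >>= (_!! c))
      ≡⟨ >>=-filterMaybe-nonEmpty (map negRow T !! r) c ⟩
    (map negRow T !! r >>= (_!! c))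
      ≡⟨ cong (_>>= (_!! c)) (!!-map negRow T r) ⟩
    (Maybe.map negRow (T !! r) >>= (_!! c))
      ≡⟨ rowwise ⟩
    filterMaybe nonEmpty (Maybe.map negValues (cell [] T r c)) ∎
    where
    open ≡-Reasoning
    rowwise : (Maybe.map negRow (T !! r) >>= (_!! c)) ≡
              filterMaybe nonEmpty (Maybe.map negValues (cell [] T r c))
    rowwise with T !! r in e
    ... | nothing = refl
    ... | just row = negRow-!! r e c

  posRow-!! : ∀ r {row} → T !! r ≡ just row → ∀ k →
    posRow row !! k ≡ Maybe.map posValues (row !! (k + μRow r))
  posRow-!! r {row} e k = begin
    posRow row !! k
      ≡⟨ filterᵇ-!!-suffix nonEmpty (map posValues row)
           (prefixClosed-map posValues not-nonEmpty-posValues row (prefixClosed-allNonPos r e)) k ⟩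
    map posValues row !! (k + length (filterᵇ (not ∘ nonEmpty) (map posValues row)))
      ≡⟨ cong (λ n → map posValues row !! (k + n))
           (trans (length-filterᵇ-map posValues not-nonEmpty-posValues row) (sym (count-row _ r e))) ⟩
    map posValues row !! (k + μRow r)
      ≡⟨ !!-map posValues row (k + μRow r) ⟩
    Maybe.map posValues (row !! (k + μRow r)) ∎
    where open ≡-Reasoning

  cell-posPart-left : ∀ r c → c ℕ.< μRow r → cell μ (posPart T) r c ≡ nothing
  cell-posPart-left r c c<μ = cell-left μ (posPart T) r c (subst (c ℕ.<_) (sym (μ-at r)) c<μ)

  cell-posPart-right : ∀ r c → μRow r ℕ.≤ c →
    cell μ (posPart T) r c ≡ Maybe.map posValues (cell [] T r c)
  cell-posPart-right r c μ≤c = trans (byRow (T !! r) refl) (cong (Maybe.map posValues) (sym (cell-[] T r c)))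
    where
    μₚ≤c : partAt μ r ℕ.≤ c
    μₚ≤c = subst (ℕ._≤ c) (sym (μ-at r)) μ≤c
    byRow : (m : Maybe (List FinSet)) → T !! r ≡ m →
      cell μ (posPart T) r c ≡ Maybe.map posValues (m >>= (_!! c))
    byRow nothing e = cell-nothing-row μ (posPart T) r c (trans (!!-map posRow T r) (cong (Maybe.map posRow) e))
    byRow (just row) e = begin
      cell μ (posPart T) r c
        ≡⟨ cell-right μ (posPart T) r c (trans (!!-map posRow T r) (cong (Maybe.map posRow) e)) μₚ≤c ⟩
      posRow row !! (c ∸ partAt μ r)
        ≡⟨ posRow-!! r e (c ∸ partAt μ r) ⟩
      Maybe.map posValues (row !! (c ∸ partAt μ r + μRow r))
        ≡⟨ cong (λ k → Maybe.map posValues (row !! k))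
             (trans (cong (c ∸ partAt μ r +_) (sym (μ-at r))) (ℕP.m∸n+n≡m μₚ≤c)) ⟩
      Maybe.map posValues (row !! c) ∎
      where open ≡-Reasoning

  cell-recombined : ∀ r c → cell [] T r c ≡ recombinedCell (splitMap T) r c
  cell-recombined r c = byColumn (c ℕ.<? μRow r)
    where
    open ≡-Reasoning
    byColumn : Dec (c ℕ.< μRow r) → cell [] T r c ≡ recombinedCell (splitMap T) r c
    byColumn (yes c<μ) = case <μRow⇒cell r c c<μ of λ where
      (X , eX , allX) → trans eX (sym (cong₂ mergeCells (begin
        cell [] (negPart T) r c
          ≡⟨ cell-negPart r c ⟩
        filterMaybe nonEmpty (Maybe.map negValues (cell [] T r c))
          ≡⟨ cong (filterMaybe nonEmpty ∘ Maybe.map negValues) eX ⟩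
        filterMaybe nonEmpty (just (negValues X))
          ≡⟨ cong (filterMaybe nonEmpty ∘ just) (filterᵇ-all isNonPos (all≡true⇒All isNonPos X allX)) ⟩
        filterMaybe nonEmpty (just X)
          ≡⟨ filterMaybe-accept nonEmpty (≢[]⇒nonEmpty X (cell-nonEmpty r c eX)) ⟩
        just X ∎) (cell-posPart-left r c c<μ)))
    byColumn (no c≮μ) = trans (mergeCells-split (cell [] T r c) (cell-sorted r c))
      (sym (cong₂ mergeCells (cell-negPart r c) (cell-posPart-right r c (ℕP.≮⇒≥ c≮μ))))

  FromCell : (FinSet → FinSet) → ℕ → ℕ → FinSet → Set
  FromCell f r c X = ∃ λ X₀ → (cell [] T r c ≡ just X₀) × (f X₀ ≡ X)

  fromCell-All₂ : {R : ℤ → ℤ → Set} (p : ℤ → Bool) → ∀ r c r′ c′ →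
    (∀ {X₀ Y₀} → cell [] T r c ≡ just X₀ → cell [] T r′ c′ ≡ just Y₀ → All₂ R X₀ Y₀) →
    ∀ {X Y} → FromCell (filterᵇ p) r c X → FromCell (filterᵇ p) r′ c′ Y → All₂ R X Y
  fromCell-All₂ p r c r′ c′ R-T (X₀ , eX₀ , refl) (Y₀ , eY₀ , refl) =
    All₂-filterᵇ p p (R-T eX₀ eY₀)

  negPart-cell-just : ∀ r c {X} → cell [] (negPart T) r c ≡ just X →
    FromCell negValues r c X × (nonEmpty X ≡ true)
  negPart-cell-just r c e with filterMaybe-just nonEmpty _ (trans (sym (cell-negPart r c)) e)
  ... | eX , neX = Maybe-map-just negValues (cell [] T r c) eX , neX

  posPart-cell-just : ∀ r c {X} → cell μ (posPart T) r c ≡ just X →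
    (μRow r ℕ.≤ c) × FromCell posValues r c X
  posPart-cell-just r c e =
    μ≤c , Maybe-map-just posValues (cell [] T r c) (trans (sym (cell-posPart-right r c μ≤c)) e)
    where
    μ≤c : μRow r ℕ.≤ c
    μ≤c = ℕP.≮⇒≥ λ c<μ → contradiction (trans (sym e) (cell-posPart-left r c c<μ)) λ ()

  map-length-negPart : map length (negPart T) ≡ ν
  map-length-negPart = begin
    map length (negPart T)                       ≡⟨ map-length-filterᵇ-nonEmpty (map negRow T) ⟩
    filterᵇ positive (map length (map negRow T)) ≡⟨ cong (filterᵇ positive) (ListP.map-∘ T) ⟨
    filterᵇ positive (map (length ∘ negRow) T)   ≡⟨ cong (filterᵇ positive) (ListP.map-cong length-negRow T) ⟩
    ν                                            ∎
    where open ≡-Reasoning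

  negPart-rowLen : ∀ r row → negPart T !! r ≡ just row → length row ≡ partAt ν r
  negPart-rowLen r row e = begin
    length row                                ≡⟨ cong (fromMaybe 0 ∘ Maybe.map length) e ⟨
    fromMaybe 0 (Maybe.map length (negPart T !! r))
                                              ≡⟨ cong (fromMaybe 0) (!!-map length (negPart T) r) ⟨
    fromMaybe 0 (map length (negPart T) !! r) ≡⟨ cong (λ xs → fromMaybe 0 (xs !! r)) map-length-negPart ⟩
    fromMaybe 0 (ν !! r)                      ≡⟨ partAt≡fromMaybe ν r ⟨
    partAt ν r                                ∎
    where open ≡-Reasoning

  negPart-bounded : ∀ r c X b → cell [] (negPart T) r c ≡ just X →
    take (length ν) (flagNeg φ) !! r ≡ just b → All (ℤ._≤ b) X
  negPart-bounded r c X b eX eb = case negPart-cell-just r c eX , b-origin of λ where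
      (((X₀ , eX₀ , refl) , _) , (b₀ , eb₀ , refl)) →
        All.zipWith (λ (x≤b₀ , x≤0) → ℤP.⊓-glb x≤b₀ x≤0)
        (AllP.filter⁺ (T? ∘ isNonPos) (bounded r c X₀ b₀ eX₀ eb₀) , negValues-nonPos X₀)
    where
    b-origin : ∃ λ b₀ → (φ !! r ≡ just b₀) × (b₀ ⊓ 0ℤ ≡ b)
    b-origin = Maybe-map-just (ℤ._⊓ 0ℤ) (φ !! r)
      (trans (sym (!!-map _ φ r)) (!!-take-just (length ν) (flagNeg φ) r eb))

  negPart-ssyt : IsSSYT (take (length ν) (flagNeg φ)) ν [] (negPart T)
  negPart-ssyt = record
    { nrows = trans (sym (ListP.length-map length (negPart T))) (cong length map-length-negPart)
    ; rowLen = negPart-rowLen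
    ; entries = λ r c X e → case negPart-cell-just r c e of λ where
        ((X₀ , eX₀ , refl) , neX) →
          nonEmpty⇒≢[] _ neX , LinkedP.filter⁺ (T? ∘ isNonPos) ℤP.<-trans (proj₂ (entries r c X₀ eX₀))
    ; rowWeak = λ r c X Y eX eY → fromCell-All₂ isNonPos r c r (suc c) (rowWeak r c _ _)
        (proj₁ (negPart-cell-just r c eX)) (proj₁ (negPart-cell-just r (suc c) eY))
    ; colStrict = λ r c X Y eX eY → fromCell-All₂ isNonPos r c (suc r) c (colStrict r c _ _)
        (proj₁ (negPart-cell-just r c eX)) (proj₁ (negPart-cell-just (suc r) c eY))
    ; bounded = negPart-bounded
    }

  posPart-rowLen : ∀ r prow → posPart T !! r ≡ just prow → length prow ≡ partAt λ′ r ∸ partAt μ r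
  posPart-rowLen r prow e = case Maybe-map-just posRow (T !! r) (trans (sym (!!-map posRow T r)) e) of λ where
      (row , eT , refl) → begin
        length (posRow row)                                     ≡⟨ ℕP.m+n∸n≡m _ (μᵣ row) ⟨
        length (posRow row) + μᵣ row ∸ μᵣ row                   ≡⟨ cong (_∸ μᵣ row) (length-posRow row) ⟩
        length row ∸ μᵣ row                                     ≡⟨ cong₂ _∸_ (rowLen r row eT)
                                                                     (trans (sym (count-row _ r eT)) (sym (μ-at r))) ⟩
        partAt λ′ r ∸ partAt μ r                                ∎
    where
    open ≡-Reasoning
    μᵣ : List FinSet → ℕ
    μᵣ = cntRow (all isNonPos)

  posPart-entries : ∀ r c X → cell μ (posPart T) r c ≡ just X → IsEntry X
  posPart-entries r c X e = case posPart-cell-just r c e of λ where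
    (μ≤c , X₀ , eX₀ , refl) →
      (λ noPos → ℕP.<⇒≱ (cell⇒<μRow r c eX₀ (trans (sym (not-nonEmpty-posValues X₀)) (cong (not ∘ nonEmpty) noPos)))
                        μ≤c) ,
      LinkedP.filter⁺ (T? ∘ isPos) ℤP.<-trans (proj₂ (entries r c X₀ eX₀))

  posPart-bounded : ∀ r c X b → cell μ (posPart T) r c ≡ just X → flagPos φ !! r ≡ just b →
    All (ℤ._≤ b) X
  posPart-bounded r c X b eX eb =
    case posPart-cell-just r c eX , Maybe-map-just (ℤ._⊔ 0ℤ) (φ !! r) (trans (sym (!!-map _ φ r)) eb) of λ where
      ((_ , X₀ , eX₀ , refl) , (b₀ , eb₀ , refl)) → AllP.filter⁺ (T? ∘ isPos)
        (All.map (λ x≤b₀ → ℤP.≤-trans x≤b₀ (ℤP.i≤i⊔j b₀ 0ℤ)) (bounded r c X₀ b₀ eX₀ eb₀))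

  posPart-ssyt : IsSSYT (flagPos φ) λ′ μ (posPart T)
  posPart-ssyt = record
    { nrows = trans (ListP.length-map posRow T) nrows
    ; rowLen = posPart-rowLen
    ; entries = posPart-entries
    ; rowWeak = λ r c X Y eX eY → fromCell-All₂ isPos r c r (suc c) (rowWeak r c _ _)
        (proj₂ (posPart-cell-just r c eX)) (proj₂ (posPart-cell-just r (suc c) eY))
    ; colStrict = λ r c X Y eX eY → fromCell-All₂ isPos r c (suc r) c (colStrict r c _ _)
        (proj₂ (posPart-cell-just r c eX)) (proj₂ (posPart-cell-just (suc r) c eY))
    ; bounded = posPart-bounded
    }

  posPart-positive : AllPositive μ (posPart T)
  posPart-positive r c X e = case posPart-cell-just r c e of λ where
    (_ , X₀ , _ , refl) → posValues-pos X₀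

  splitMap-inTarget : InTarget φ λ′ (splitMap T)
  splitMap-inTarget = ν-partition , ν⊆λ , negPart-ssyt , μ-partition , μ⊆ν , ν/μ-disconnected ,
                      posPart-ssyt , posPart-positive

splitMap-injective : {φ : List ℤ} {λ′ : List ℕ} → IsPartition λ′ → (T T′ : Tab) →
  IsSSYT φ λ′ [] T → IsSSYT φ λ′ [] T′ → splitMap T ≡ splitMap T′ → T ≡ T′
splitMap-injective λ-partition T T′ T-ssyt T′-ssyt eq =
  cell-extensionality [] T T′ (trans (IsSSYT.nrows T-ssyt) (sym (IsSSYT.nrows T′-ssyt))) λ r c → begin
    cell [] T r c                      ≡⟨ Decomposition.cell-recombined λ-partition T-ssyt r c ⟩
    recombinedCell (splitMap T) r c    ≡⟨ cong (λ t → recombinedCell t r c) eq ⟩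
    recombinedCell (splitMap T′) r c   ≡⟨ Decomposition.cell-recombined λ-partition T′-ssyt r c ⟨
    cell [] T′ r c                     ∎
  where open ≡-Reasoning

-- Gluing a non-positive tableau and a positive skew tableau

module Gluing {φ : List ℤ} {λ′ : List ℕ} (λ-partition : IsPartition λ′) (flag : IsFlag φ λ′)
  {ν : List ℕ} {S : Tab} {μ : List ℕ} {U : Tab}
  (ν-partition : IsPartition ν) (ν⊆λ : ν ⊆ₚ λ′) (S-ssyt : IsSSYT (take (length ν) (flagNeg φ)) ν [] S)
  (μ-partition : IsPartition μ) (μ⊆ν : μ ⊆ₚ ν) (ν/μ-disconnected : Disconnected ν μ)
  (U-ssyt : IsSSYT (flagPos φ) λ′ μ U) (U-positive : AllPositive μ U) where

  module S-shape = SkewShape S-ssyt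
  module U-shape = SkewShape U-ssyt

  gluedCell : ℕ → ℕ → Maybe FinSet
  gluedCell = recombinedCell (split ν S μ U)

  glued : Tab
  glued = map (λ r → map (λ c → flat (gluedCell r c)) (upTo (partAt λ′ r))) (upTo (length λ′))

  S-bounded : ∀ r c {X} b → cell [] S r c ≡ just X → φ !! r ≡ just b → All (ℤ._≤ b ⊓ 0ℤ) X
  S-bounded r c {X} b eX eb = IsSSYT.bounded S-ssyt r c X (b ⊓ 0ℤ) eX (begin
    take (length ν) (flagNeg φ) !! r ≡⟨ !!-take (length ν) (flagNeg φ) r r<ℓν ⟩
    flagNeg φ !! r                   ≡⟨ !!-map (ℤ._⊓ 0ℤ) φ r ⟩
    Maybe.map (ℤ._⊓ 0ℤ) (φ !! r)     ≡⟨ cong (Maybe.map (ℤ._⊓ 0ℤ)) eb ⟩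
    just (b ⊓ 0ℤ)                    ∎)
    where
    open ≡-Reasoning
    r<ℓν : r ℕ.< length ν
    r<ℓν = subst (r ℕ.<_) (IsSSYT.nrows S-ssyt) (!!-just⇒<length S r (proj₂ (cell-just⇒row [] S r c eX)))

  -- `bounded` says nothing about rows where φ has no entry; the length of the flag is what
  -- makes every row of ν bounded by min(φᵣ, 0) ≤ 0
  S-nonPos : ∀ r c {X} → cell [] S r c ≡ just X → All (ℤ._≤ 0ℤ) X
  S-nonPos r c eX = case <length⇒!!-just φ r r<ℓφ of λ where
      (b , eb) → All.map (λ x≤b⊓0 → ℤP.≤-trans x≤b⊓0 (ℤP.i⊓j≤j b 0ℤ)) (S-bounded r c b eX eb)
    where
    r<ℓφ : r ℕ.< length φ
    r<ℓφ = subst (r ℕ.<_) (sym (proj₂ flag)) (0<partAt⇒<length λ′ r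
      (ℕP.<-≤-trans (ℕP.≤-<-trans z≤n (proj₂ (S-shape.cell-just⇒InSkew r c eX))) (ν⊆λ r)))

  U-bounded : ∀ r c {X} b → cell μ U r c ≡ just X → φ !! r ≡ just b → All (ℤ._≤ b) X
  U-bounded r c {X} b eX eb = All.zipWith (λ (0<x , x≤b⊔0) → 0<x≤b⊔0⇒x≤b 0<x x≤b⊔0)
    (U-positive r c X eX ,
     IsSSYT.bounded U-ssyt r c X (b ⊔ 0ℤ) eX
       (trans (!!-map (ℤ._⊔ 0ℤ) φ r) (cong (Maybe.map (ℤ._⊔ 0ℤ)) eb)))

  S-nonPosEntry : ∀ r c {A} → cell [] S r c ≡ just A → NonPosEntry A
  S-nonPosEntry r c eA = IsSSYT.entries S-ssyt r c _ eA , S-nonPos r c eA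

  S-entry : ∀ r c → MaybeAll NonPosEntry (cell [] S r c)
  S-entry r c with cell [] S r c in e
  ... | nothing = nothing
  ... | just X = just (S-nonPosEntry r c e)

  U-entry : ∀ r c → MaybeAll PosEntry (cell μ U r c)
  U-entry r c with cell μ U r c in e
  ... | nothing = nothing
  ... | just X = just (IsSSYT.entries U-ssyt r c X e , U-positive r c X e)

  gluedCell-outside : ∀ r c → partAt λ′ r ℕ.≤ c → gluedCell r c ≡ nothing
  gluedCell-outside r c λ≤c = cong₂ mergeCells
    (S-shape.¬InSkew⇒cell-nothing r c λ (_ , c<ν) → ℕP.<⇒≱ (ℕP.<-≤-trans c<ν (ν⊆λ r)) λ≤c)
    (U-shape.¬InSkew⇒cell-nothing r c λ (_ , c<λ) → ℕP.<⇒≱ c<λ λ≤c)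

  gluedCell-inside : ∀ r c → c ℕ.< partAt λ′ r → ∃ λ X → gluedCell r c ≡ just X
  gluedCell-inside r c c<λ with c ℕ.<? partAt μ r
  ... | yes c<μ with S-shape.InSkew⇒cell-just r c (z≤n , ℕP.<-≤-trans c<μ (μ⊆ν r))
  ...   | A , eA rewrite eA = mergeCells-justˡ A (cell μ U r c)
  gluedCell-inside r c c<λ | no c≮μ with U-shape.InSkew⇒cell-just r c (ℕP.≮⇒≥ c≮μ , c<λ)
  ...   | B , eB rewrite eB = mergeCells-justʳ (cell [] S r c) B

  cell-glued : ∀ r c → cell [] glued r c ≡ gluedCell r c
  cell-glued r c = trans (cell-[] glued r c)
    (trans (cong (_>>= (_!! c)) (!!-map _ (upTo (length λ′)) r)) (byRow (r ℕ.<? length λ′)))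
    where
    byColumn : Dec (c ℕ.< partAt λ′ r) →
      Maybe.map (flat ∘ gluedCell r) (upTo (partAt λ′ r) !! c) ≡ gluedCell r c
    byColumn (yes c<λ) rewrite !!-upTo (partAt λ′ r) c c<λ =
      flat-just (gluedCell r c) (proj₂ (gluedCell-inside r c c<λ))
    byColumn (no c≮λ) rewrite upTo-!!-≥ (partAt λ′ r) c (ℕP.≮⇒≥ c≮λ) =
      sym (gluedCell-outside r c (ℕP.≮⇒≥ c≮λ))
    byRow : Dec (r ℕ.< length λ′) →
      (Maybe.map (λ r → map (λ c → flat (gluedCell r c)) (upTo (partAt λ′ r))) (upTo (length λ′) !! r)
        >>= (_!! c))
        ≡ gluedCell r c
    byRow (yes r<ℓλ) rewrite !!-upTo (length λ′) r r<ℓλ =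
      trans (!!-map (flat ∘ gluedCell r) (upTo (partAt λ′ r)) c) (byColumn (c ℕ.<? partAt λ′ r))
    byRow (no r≮ℓλ) rewrite upTo-!!-≥ (length λ′) r (ℕP.≮⇒≥ r≮ℓλ) =
      sym (gluedCell-outside r c (subst (ℕ._≤ c) (sym (length≤⇒partAt≡0 λ′ r (ℕP.≮⇒≥ r≮ℓλ))) z≤n))

  glued-just : ∀ r c {X} → cell [] glued r c ≡ just X → gluedCell r c ≡ just X
  glued-just r c eX = trans (sym (cell-glued r c)) eX

  glued-values : ∀ r c {X} → cell [] glued r c ≡ just X → X ≡ flat (cell [] S r c) ++ flat (cell μ U r c)
  glued-values r c eX = mergeCells-just (cell [] S r c) (cell μ U r c) (glued-just r c eX)

  glued-All₂ : {R : ℤ → ℤ → Set} → (∀ {x y} → x ℤ.≤ 0ℤ → 0ℤ ℤ.< y → R x y) →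
    ∀ r c r′ c′ →
    (∀ {A B} → cell [] S r c ≡ just A → cell [] S r′ c′ ≡ just B → All₂ R A B) →
    (∀ {A B} → cell μ U r c ≡ just A → cell [] S r′ c′ ≡ just B → ⊥) →
    (∀ {A B} → cell μ U r c ≡ just A → cell μ U r′ c′ ≡ just B → All₂ R A B) →
    ∀ {X Y} → cell [] glued r c ≡ just X → cell [] glued r′ c′ ≡ just Y → All₂ R X Y
  glued-All₂ {R} R-sign r c r′ c′ S-S U-S U-U eX eY =
    subst₂ (All₂ R) (sym (glued-values r c eX)) (sym (glued-values r′ c′ eY)) (All₂-++
      (All₂-flat (cell [] S r c) (cell [] S r′ c′) S-S)
      (All₂-flat (cell [] S r c) (cell μ U r′ c′) λ eA eB →
         sign⇒All₂ R-sign (S-nonPos r c eA) (U-positive r′ c′ _ eB))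
      (All₂-flat (cell μ U r c) (cell [] S r′ c′) λ eA eB → ⊥-elim (U-S eA eB))
      (All₂-flat (cell μ U r c) (cell μ U r′ c′) U-U))

  U-left-of-S : ∀ r c {A B} → cell μ U r c ≡ just A → cell [] S r (suc c) ≡ just B → ⊥
  U-left-of-S r c eA eB =
    proj₁ (ν/μ-disconnected r c (μ≤c , ℕP.<-trans (ℕP.n<1+n c) c+1<ν)) (ℕP.m≤n⇒m≤1+n μ≤c , c+1<ν)
    where
    μ≤c : partAt μ r ℕ.≤ c
    μ≤c = proj₁ (U-shape.cell-just⇒InSkew r c eA)
    c+1<ν : suc c ℕ.< partAt ν r
    c+1<ν = proj₂ (S-shape.cell-just⇒InSkew r (suc c) eB)

  U-above-S : ∀ r c {A B} → cell μ U r c ≡ just A → cell [] S (suc r) c ≡ just B → ⊥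
  U-above-S r c eA eB =
    proj₂ (ν/μ-disconnected r c (μ≤c , ℕP.<-≤-trans c<ν′ (Linked⇒Decreasing ν (proj₁ ν-partition) r)))
          (ℕP.≤-trans (Linked⇒Decreasing μ (proj₁ μ-partition) r) μ≤c , c<ν′)
    where
    μ≤c : partAt μ r ℕ.≤ c
    μ≤c = proj₁ (U-shape.cell-just⇒InSkew r c eA)
    c<ν′ : c ℕ.< partAt ν (suc r)
    c<ν′ = proj₂ (S-shape.cell-just⇒InSkew (suc r) c eB)

  glued-ssyt : IsSSYT φ λ′ [] glued
  glued-ssyt = record
    { nrows = trans (ListP.length-map _ (upTo (length λ′))) (ListP.length-upTo (length λ′))
    ; rowLen = rowLen
    ; entries = λ r c X eX → drop-just
        (subst (MaybeAll IsEntry) (glued-just r c eX) (mergeCells-IsEntry (S-entry r c) (U-entry r c)))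
    ; rowWeak = λ r c X Y → glued-All₂ (λ x≤0 0<y → ℤP.<⇒≤ (ℤP.≤-<-trans x≤0 0<y)) r c r (suc c)
        (IsSSYT.rowWeak S-ssyt r c _ _) (U-left-of-S r c) (IsSSYT.rowWeak U-ssyt r c _ _)
    ; colStrict = λ r c X Y → glued-All₂ ℤP.≤-<-trans r c (suc r) c
        (IsSSYT.colStrict S-ssyt r c _ _) (U-above-S r c) (IsSSYT.colStrict U-ssyt r c _ _)
    ; bounded = λ r c X b eX eb → subst (All (ℤ._≤ b)) (sym (glued-values r c eX)) (AllP.++⁺
        (All.map (λ x≤b⊓0 → ℤP.≤-trans x≤b⊓0 (ℤP.i⊓j≤i b 0ℤ))
           (All₁-flat (cell [] S r c) λ eA → S-bounded r c b eA eb))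
        (All₁-flat (cell μ U r c) λ eA → U-bounded r c b eA eb))
    }
    where
    rowLen : ∀ r row → glued !! r ≡ just row → length row ≡ partAt λ′ r
    rowLen r row e with r ℕ.<? length λ′
    ... | yes r<ℓλ = trans (cong length (just-injective (trans (sym e) (trans (!!-map _ (upTo (length λ′)) r)
                       (cong (Maybe.map _) (!!-upTo (length λ′) r r<ℓλ))))))
                       (trans (ListP.length-map _ (upTo (partAt λ′ r))) (ListP.length-upTo (partAt λ′ r)))
    ... | no r≮ℓλ = contradiction (trans (sym e) (trans (!!-map _ (upTo (length λ′)) r)
                       (cong (Maybe.map _) (upTo-!!-≥ (length λ′) r (ℕP.≮⇒≥ r≮ℓλ))))) λ ()

  module G = Decomposition λ-partition glued-ssyt
  module G-shape = SkewShape glued-ssyt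

  νRow≡ν : ∀ r → G.νRow r ≡ partAt ν r
  νRow≡ν r = ℕP.≤-antisym (∀<⇒≤ _ _ anyNonPos⇒inν) (∀<⇒≤ _ _ inν⇒anyNonPos)
    where
    anyNonPos⇒inν : ∀ c → c ℕ.< G.νRow r → c ℕ.< partAt ν r
    anyNonPos⇒inν c c<ν = case G.<νRow⇒cell r c c<ν of λ where
      (X , eX , anyX) → proj₂ (S-shape.cell-just⇒InSkew r c (proj₂
        (anyNonPos-mergeCells (cell [] S r c) (cell μ U r c) (U-entry r c) (glued-just r c eX) anyX)))
    inν⇒anyNonPos : ∀ c → c ℕ.< partAt ν r → c ℕ.< G.νRow r
    inν⇒anyNonPos c c<ν = case S-shape.InSkew⇒cell-just r c (z≤n , c<ν) of λ where
      (A , eA) → case mergeCells-anyNonPos A (cell μ U r c) (S-nonPosEntry r c eA) of λ where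
        (X , eX , anyX) → G.cell⇒<νRow r c
          (trans (cell-glued r c) (trans (cong (λ s → mergeCells s (cell μ U r c)) eA) eX)) anyX

  μRow≡μ : ∀ r → G.μRow r ≡ partAt μ r
  μRow≡μ r = ℕP.≤-antisym (∀<⇒≤ _ _ allNonPos⇒inμ) (∀<⇒≤ _ _ inμ⇒allNonPos)
    where
    allNonPos⇒inμ : ∀ c → c ℕ.< G.μRow r → c ℕ.< partAt μ r
    allNonPos⇒inμ c c<μ = case G.<μRow⇒cell r c c<μ of λ where
      (X , eX , allX) → ℕP.≰⇒> λ μ≤c → contradiction
        (trans (sym (proj₂ (U-shape.InSkew⇒cell-just r c (μ≤c , proj₂ (G-shape.cell-just⇒InSkew r c eX)))))
               (allNonPos-mergeCells (cell [] S r c) (cell μ U r c) (U-entry r c) (glued-just r c eX) allX))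
        λ ()
    inμ⇒allNonPos : ∀ c → c ℕ.< partAt μ r → c ℕ.< G.μRow r
    inμ⇒allNonPos c c<μ = case S-shape.InSkew⇒cell-just r c (z≤n , ℕP.<-≤-trans c<μ (μ⊆ν r)) of λ where
      (A , eA) → G.cell⇒<μRow r c (trans (cell-glued r c) (cong₂ mergeCells eA (cell-left μ U r c c<μ)))
        (NonPosEntry⇒allNonPos (S-nonPosEntry r c eA))

  nuShape-glued : nuShape glued ≡ ν
  nuShape-glued = partAt-injective _ _ (proj₂ G.ν-partition) (proj₂ ν-partition)
    λ r → trans (G.ν-at r) (νRow≡ν r)

  muShape-glued : muShape glued ≡ μ
  muShape-glued = partAt-injective _ _ (proj₂ G.μ-partition) (proj₂ μ-partition)
    λ r → trans (G.μ-at r) (μRow≡μ r)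

  negPart-glued : negPart glued ≡ S
  negPart-glued = cell-extensionality [] (negPart glued) S
    (trans (IsSSYT.nrows G.negPart-ssyt) (trans (cong length nuShape-glued) (sym (IsSSYT.nrows S-ssyt))))
    λ r c → begin
      cell [] (negPart glued) r c
        ≡⟨ G.cell-negPart r c ⟩
      filterMaybe nonEmpty (Maybe.map negValues (cell [] glued r c))
        ≡⟨ cong (filterMaybe nonEmpty ∘ Maybe.map negValues) (cell-glued r c) ⟩
      filterMaybe nonEmpty (Maybe.map negValues (gluedCell r c))
        ≡⟨ negValues-mergeCells (S-entry r c) (U-entry r c) ⟩
      cell [] S r c ∎
    where open ≡-Reasoning

  posPart-glued : posPart glued ≡ U
  posPart-glued = cell-extensionality μ (posPart glued) U
    (trans (ListP.length-map posRow glued) (trans (IsSSYT.nrows glued-ssyt) (sym (IsSSYT.nrows U-ssyt))))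
    λ r c → trans (cong (λ μ′ → cell μ′ (posPart glued) r c) (sym muShape-glued))
                  (byColumn r c (c ℕ.<? G.μRow r))
    where
    byColumn : ∀ r c → Dec (c ℕ.< G.μRow r) → cell (muShape glued) (posPart glued) r c ≡ cell μ U r c
    byColumn r c (yes c<μ) =
      trans (G.cell-posPart-left r c c<μ) (sym (cell-left μ U r c (subst (c ℕ.<_) (μRow≡μ r) c<μ)))
    byColumn r c (no c≮μ) = trans (G.cell-posPart-right r c (ℕP.≮⇒≥ c≮μ))
      (trans (cong (Maybe.map posValues) (cell-glued r c)) (byEntry (cell μ U r c) refl (U-entry r c)))
      where
      μ≤c : partAt μ r ℕ.≤ c
      μ≤c = subst (ℕ._≤ c) (μRow≡μ r) (ℕP.≮⇒≥ c≮μ)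
      byEntry : (u : Maybe FinSet) → cell μ U r c ≡ u → MaybeAll PosEntry u →
        Maybe.map posValues (mergeCells (cell [] S r c) u) ≡ u
      byEntry (just B) _ (just (_ , 0<B)) = posValues-mergeCells (S-entry r c) 0<B
      byEntry nothing eU nothing = noS (cell [] S r c) refl
        where
        noS : (s : Maybe FinSet) → cell [] S r c ≡ s → Maybe.map posValues (mergeCells s nothing) ≡ nothing
        noS nothing _ = refl
        noS (just A) eS = contradiction (trans (sym eU) (proj₂ (U-shape.InSkew⇒cell-just r c
          (μ≤c , ℕP.<-≤-trans (proj₂ (S-shape.cell-just⇒InSkew r c eS)) (ν⊆λ r))))) λ ()

  splitMap-glued : splitMap glued ≡ split ν S μ U
  splitMap-glued = cong₂ (λ (ν′ , S′) (μ′ , U′) → split ν′ S′ μ′ U′)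
    (cong₂ _,_ nuShape-glued negPart-glued) (cong₂ _,_ muShape-glued posPart-glued)

lemma3p2 : (φ : List ℤ) (λ′ : List ℕ) → IsPartition λ′ → IsFlag φ λ′ →
    ((T : Tab) → IsSSYT φ λ′ [] T → InTarget φ λ′ (splitMap T))
    × ((T T′ : Tab) → IsSSYT φ λ′ [] T → IsSSYT φ λ′ [] T′ → splitMap T ≡ splitMap T′ → T ≡ T′)
    × ((t : Split) → InTarget φ λ′ t → ∃ (λ T → IsSSYT φ λ′ [] T × splitMap T ≡ t))
lemma3p2 φ λ′ λ-partition flag =
  (λ T T-ssyt → Decomposition.splitMap-inTarget λ-partition T-ssyt) ,
  splitMap-injective λ-partition ,
  λ { (split ν S μ U) (ν-partition , ν⊆λ , S-ssyt , μ-partition , μ⊆ν , disconnected , U-ssyt , U-positive) →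
        let open Gluing λ-partition flag ν-partition ν⊆λ S-ssyt μ-partition μ⊆ν disconnected U-ssyt U-positive
        in glued , glued-ssyt , splitMap-glued }
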